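{- Let $G$ be an abelian group of odd order $v$ and let $A$ be a group of odd order $k$ of fixed-point-free automorphisms of $G$. Then there exists a Banff $(v,k,\frac{k-1}{2})$ difference family in $G$.
   Context: A group $A$ of automorphisms of $G$ is fixed-point-free if every non-identity element of $A$ fixes only $0\in G$. A $(v,k,\lambda)$ difference family in an additive group $G$ of order $v$ is a set $\mathcal F$ of $k$-subsets of $G$ (base blocks) such that the list $\{x-y: x,y\in B, x\neq y, B\in\mathcal F\}$ contains every nonzero element of $G$ exactly $\lambda$ times. A Banff difference family is a difference family $\{B_1,\dots,B_n\}$ whose base blocks are pairwise disjoint, such that $0\notin B_i$ for all $i$ and $B_i\cap -B_j=\emptyset$ for every pair $(i,j)$ (including $i=j$), where $-B=\{ -b:b\in B\}$. -}

module Defs where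

open import Data.Nat using (ℕ; suc; _*_)
open import Data.Fin using (Fin; _≟_)
open import Data.List using (List; length; filter; map; concatMap)
open import Data.List.Membership.Propositional using (_∈_; _∉_)
open import Data.List.Relation.Unary.All using (All)
open import Data.List.Relation.Unary.Any using (Any)
open import Data.List.Relation.Unary.AllPairs using (AllPairs)
open import Data.List.Relation.Unary.Unique.Propositional using (Unique)
open import Data.Product using (∃; _×_)
open import Function.Definitions using (Bijective)
open import Relation.Nullary using (¬_; ¬?)
open import Relation.Binary.PropositionalEquality using (_≡_; _≢_)

Odd : ℕ → Set
Odd n = ∃ λ m → n ≡ suc (2 * m)

_≗ᶠ_ : ∀ {v} → (Fin v → Fin v) → (Fin v → Fin v) → Set
f ≗ᶠ g = ∀ x → f x ≡ g x

_∈ᶠ_ : ∀ {v} → (Fin v → Fin v) → List (Fin v → Fin v) → Set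
f ∈ᶠ As = Any (λ τ → τ ≗ᶠ f) As

-- Throughout, a finite (abelian) group of order v is given by operations on
-- the carrier Fin v (with propositional equality).
module _ {v : ℕ} (_+_ : Fin v → Fin v → Fin v) (0# : Fin v) (-_ : Fin v → Fin v) where

  IsAutomorphism : (Fin v → Fin v) → Set
  IsAutomorphism σ = (∀ x y → σ (x + y) ≡ σ x + σ y) × Bijective _≡_ _≡_ σ

  -- The list As enumerates (without repetition) a subgroup of Aut(G)
  IsAutGroup : List (Fin v → Fin v) → Set
  IsAutGroup As =
      All IsAutomorphism As
    × AllPairs (λ σ τ → ¬ (σ ≗ᶠ τ)) As
    × ((λ x → x) ∈ᶠ As)
    × All (λ σ → All (λ τ → (λ x → σ (τ x)) ∈ᶠ As) As) As
    × All (λ σ → Any (λ τ → (λ x → τ (σ x)) ≗ᶠ (λ x → x)) As) As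

  FixedPointFree : List (Fin v → Fin v) → Set
  FixedPointFree As =
    All (λ σ → ¬ (σ ≗ᶠ (λ x → x)) → ∀ x → σ x ≡ x → x ≡ 0#) As

  diffs : List (Fin v) → List (Fin v)
  diffs B = concatMap (λ x → map (λ y → x + (- y)) (filter (λ y → ¬? (x ≟ y)) B)) B

  diffCount : List (List (Fin v)) → Fin v → ℕ
  diffCount F g = length (filter (λ d → d ≟ g) (concatMap diffs F))

  IsDifferenceFamily : ℕ → ℕ → List (List (Fin v)) → Set
  IsDifferenceFamily k λ' F =
      All (λ B → Unique B × length B ≡ k) F
    × (∀ g → g ≢ 0# → diffCount F g ≡ λ')

  Disjoint : List (Fin v) → List (Fin v) → Set
  Disjoint B C = ∀ {x} → x ∈ B → x ∉ C

  IsBanffDF : ℕ → ℕ → List (List (Fin v)) → Set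
  IsBanffDF k λ' F =
      IsDifferenceFamily k λ' F
    × AllPairs Disjoint F
    × All (λ B → 0# ∉ B) F
    × All (λ B → All (λ C → ∀ {x} → x ∈ B → (- x) ∉ C) F) F

-- The base blocks are A-orbits A·x of nonzero x. As A acts fixed-point-freely, each such orbit
-- has exactly k elements, and since v and k are odd no orbit contains both z and -z (otherwise
-- G or A would have an element of order two). Greedily choose orbits so that their union contains
-- exactly one of z, -z for every z ≠ 0; the Banff conditions are then immediate.
-- For g ≠ 0 the number of representations of g as a difference is the sum over ρ ∈ A of the
-- number of chosen z with z - ρz = g. For ρ = 1 this is 0. For ρ ≠ 1 the map z ↦ z - ρz is
-- injective, hence bijective, with a unique solution y, and the solution for ρ⁻¹ is -ρy; as ρy
-- is chosen iff y is, the terms for ρ and ρ⁻¹ add up to 1, so the total is (k - 1)/2.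
module Submission where

open import Defs
open import Algebra.Bundles using (Group)
import Algebra.Properties.Group as GroupProperties
open import Algebra.Structures using (IsGroup; IsAbelianGroup)
open import Data.Empty using (⊥-elim)
open import Data.Fin.Base using (Fin; zero; suc; punchIn; punchOut)
open import Data.Fin.Permutation using (permutation)
import Data.Fin.Properties as Fin
open import Data.List.Base
  using (List; []; _∷_; _++_; map; filter; concatMap; length; lookup; tabulate; foldl; allFin)
open import Data.List.Membership.Propositional using (_∈_; _∉_; find; lose)
open import Data.List.Membership.Propositional.Properties using (∈-lookup; ∈-tabulate⁻; ∈-allFin)
import Data.List.Properties as List
open import Data.List.Relation.Unary.All using (All; []; _∷_)
import Data.List.Relation.Unary.All as All
open import Data.List.Relation.Unary.All.Properties using (All¬⇒¬Any) renaming (map⁺ to All-map⁺)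
open import Data.List.Relation.Unary.AllPairs using (AllPairs; []; _∷_)
import Data.List.Relation.Unary.AllPairs as AllPairs
open import Data.List.Relation.Unary.AllPairs.Properties using () renaming (map⁺ to AllPairs-map⁺)
open import Data.List.Relation.Unary.Any using (Any; here; there)
import Data.List.Relation.Unary.Any as Any
open import Data.List.Relation.Unary.Any.Properties using (lookup-index)
open import Data.List.Relation.Unary.Unique.Propositional using (Unique)
open import Data.List.Relation.Unary.Unique.Propositional.Properties
  using () renaming (tabulate⁺ to Unique-tabulate⁺)
open import Data.Nat.Base using (ℕ; zero; suc; _+_; _*_; _∸_; _/_)
open import Data.Nat.DivMod using (m*n/n≡m)
open import Data.Nat.ListAction using () renaming (sum to sumᴸ)
import Data.Nat.Properties as ℕ
open import Data.Product using (∃; _×_; _,_; proj₁; proj₂)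
open import Data.Sum using (_⊎_; inj₁; inj₂)
import Data.Sum as Sum
open import Function.Base using (_∘_)
open import Function.Definitions using (Injective)
open import Relation.Binary.Core using (Rel)
open import Relation.Binary.Definitions using (Symmetric)
open import Relation.Binary.PropositionalEquality
  using (_≡_; _≢_; refl; sym; trans; cong; cong₂; isEquivalence; module ≡-Reasoning)
open import Relation.Nullary using (Dec; yes; no; ¬_; ¬?)
open import Relation.Nullary.Decidable using (decidable-stable)
open import Relation.Unary using (Pred; Decidable)
open import Algebra.Properties.Semiring.Sum ℕ.+-*-semiring
  using (sum; sum-cong-≗; sum-replicate-zero; sum-remove; sum-permute; ∑-distrib-+; ∑-comm; *-distribˡ-sum)

[_] : ∀ {p} {P : Set p} → Dec P → ℕ
[ yes _ ] = 1
[ no _ ] = 0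

[]-yes : ∀ {p} {P : Set p} (d : Dec P) → P → [ d ] ≡ 1
[]-yes (yes _) _ = refl
[]-yes (no ¬p) p = ⊥-elim (¬p p)

[]-no : ∀ {p} {P : Set p} (d : Dec P) → ¬ P → [ d ] ≡ 0
[]-no (yes p) ¬p = ⊥-elim (¬p p)
[]-no (no _) _ = refl

[]-cong : ∀ {p q} {P : Set p} {Q : Set q} → (P → Q) → (Q → P) → (d : Dec P) (e : Dec Q) → [ d ] ≡ [ e ]
[]-cong P→Q Q→P (yes p) e = sym ([]-yes e (P→Q p))
[]-cong P→Q Q→P (no ¬p) e = sym ([]-no e (¬p ∘ Q→P))

[]-complement : ∀ {p} {P : Set p} (d : Dec P) → [ d ] + [ ¬? d ] ≡ 1
[]-complement (yes _) = refl
[]-complement (no _) = refl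

module _ {a p} {A : Set a} {P : Pred A p} (P? : Decidable P) where

  length-filter : ∀ xs → length (filter P? xs) ≡ sumᴸ (map (λ x → [ P? x ]) xs)
  length-filter [] = refl
  length-filter (x ∷ xs) with P? x
  ... | yes _ = cong suc (length-filter xs)
  ... | no _ = length-filter xs

  sumᴸ-filter : (h : A → ℕ) → (∀ x → ¬ P x → h x ≡ 0) →
                ∀ xs → sumᴸ (map h (filter P? xs)) ≡ sumᴸ (map h xs)
  sumᴸ-filter h h≡0 [] = refl
  sumᴸ-filter h h≡0 (x ∷ xs) with P? x
  ... | yes _ = cong (h x +_) (sumᴸ-filter h h≡0 xs)
  ... | no ¬p = trans (sumᴸ-filter h h≡0 xs) (cong (_+ sumᴸ (map h xs)) (sym (h≡0 x ¬p)))

  sumᴸ-exclusive : ∀ xs → AllPairs (λ x y → ¬ (P x × P y)) xs → (d : Dec (Any P xs)) →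
                   sumᴸ (map (λ x → [ P? x ]) xs) ≡ [ d ]
  sumᴸ-exclusive [] [] (yes ())
  sumᴸ-exclusive [] [] (no _) = refl
  sumᴸ-exclusive (x ∷ xs) (excl ∷ excls) d with P? x | d
  ... | yes px | yes _ =
    cong suc (sumᴸ-exclusive xs excls (no (All¬⇒¬Any (All.map (λ ¬both py → ¬both (px , py)) excl))))
  ... | yes px | no ¬any = ⊥-elim (¬any (here px))
  ... | no ¬px | yes (here px) = ⊥-elim (¬px px)
  ... | no _ | yes (there any) = sumᴸ-exclusive xs excls (yes any)
  ... | no _ | no ¬any = sumᴸ-exclusive xs excls (no (¬any ∘ there))

module _ {a b} {A : Set a} {B : Set b} where

  length-filter-concatMap : ∀ {p} {P : Pred B p} (P? : Decidable P) (f : A → List B) xs →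
    length (filter P? (concatMap f xs)) ≡ sumᴸ (map (λ x → length (filter P? (f x))) xs)
  length-filter-concatMap P? f [] = refl
  length-filter-concatMap P? f (x ∷ xs) = begin
    length (filter P? (f x ++ concatMap f xs))
      ≡⟨ cong length (List.filter-++ P? (f x) (concatMap f xs)) ⟩
    length (filter P? (f x) ++ filter P? (concatMap f xs))
      ≡⟨ List.length-++ (filter P? (f x)) ⟩
    length (filter P? (f x)) + length (filter P? (concatMap f xs))
      ≡⟨ cong (length (filter P? (f x)) +_) (length-filter-concatMap P? f xs) ⟩
    length (filter P? (f x)) + sumᴸ (map (λ x → length (filter P? (f x))) xs) ∎
    where open ≡-Reasoning

sum-zero : ∀ {n} (f : Fin n → ℕ) → (∀ i → f i ≡ 0) → sum f ≡ 0
sum-zero {n} f f≡0 = trans (sum-cong-≗ f≡0) (sum-replicate-zero n)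

sumᴸ-* : ∀ {a} {A : Set a} (f : A → ℕ) c xs → sumᴸ (map (λ x → f x * c) xs) ≡ sumᴸ (map f xs) * c
sumᴸ-* f c [] = refl
sumᴸ-* f c (x ∷ xs) = trans (cong (f x * c +_) (sumᴸ-* f c xs)) (sym (ℕ.*-distribʳ-+ c (f x) (sumᴸ (map f xs))))

sumᴸ-map-tabulate : ∀ {a} {A : Set a} {n} (h : A → ℕ) (f : Fin n → A) → sumᴸ (map h (tabulate f)) ≡ sum (h ∘ f)
sumᴸ-map-tabulate {n = zero} h f = refl
sumᴸ-map-tabulate {n = suc n} h f = cong (h (f zero) +_) (sumᴸ-map-tabulate h (f ∘ suc))

sumᴸ-sum-comm : ∀ {a} {A : Set a} {n} (f : A → Fin n → ℕ) xs →
  sumᴸ (map (λ x → sum (f x)) xs) ≡ sum (λ j → sumᴸ (map (λ x → f x j) xs))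
sumᴸ-sum-comm {n = n} f [] = sym (sum-zero {n} _ (λ _ → refl))
sumᴸ-sum-comm f (x ∷ xs) = trans (cong (sum (f x) +_) (sumᴸ-sum-comm f xs)) (sym (∑-distrib-+ (f x) _))

sum-ones : ∀ n → sum {n} (λ _ → 1) ≡ n
sum-ones zero = refl
sum-ones (suc n) = cong suc (sum-ones n)

sum-iverson-none : ∀ {n p} {P : Pred (Fin n) p} (P? : Decidable P) (h : Fin n → ℕ) →
  (∀ i → ¬ P i) → sum (λ i → [ P? i ] * h i) ≡ 0
sum-iverson-none P? h ¬P = sum-zero _ (λ i → cong (_* h i) ([]-no (P? i) (¬P i)))

sum-iverson-unique : ∀ {n p} {P : Pred (Fin n) p} (P? : Decidable P) (h : Fin n → ℕ) →
  ∀ {i₀} → P i₀ → (∀ {i} → P i → i ≡ i₀) → sum (λ i → [ P? i ] * h i) ≡ h i₀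
sum-iverson-unique {suc n} P? h {i₀} Pi₀ unique = begin
  sum t                                ≡⟨ sum-remove t ⟩
  t i₀ + sum (λ j → t (punchIn i₀ j))
    ≡⟨ cong₂ _+_ (cong (_* h i₀) ([]-yes (P? i₀) Pi₀))
                 (sum-iverson-none (P? ∘ punchIn i₀) (h ∘ punchIn i₀)
                                   (λ j → Fin.punchInᵢ≢i i₀ j ∘ unique)) ⟩
  1 * h i₀ + 0                         ≡⟨ ℕ.+-identityʳ (1 * h i₀) ⟩
  1 * h i₀                             ≡⟨ ℕ.*-identityˡ (h i₀) ⟩
  h i₀                                 ∎
  where
  open ≡-Reasoning
  t : Fin (suc n) → ℕ
  t i = [ P? i ] * h i

fixedPointFreeInvolution⇒¬Odd : ∀ {m} (σ : Fin m → Fin m) →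
  (∀ x → σ (σ x) ≡ x) → (∀ x → σ x ≢ x) → ¬ Odd m
fixedPointFreeInvolution⇒¬Odd {m} σ involutive fixedPointFree (k , m≡1+2k) =
  ℕ.even≢odd below k (trans (sym m≡2*below) m≡1+2k)
  where
  below : ℕ
  below = sum (λ x → [ x Fin.<? σ x ])

  above : ℕ
  above = sum (λ x → [ σ x Fin.<? x ])

  one-side : ∀ x → 1 ≡ [ x Fin.<? σ x ] + [ σ x Fin.<? x ]
  one-side x with x Fin.<? σ x | σ x Fin.<? x
  ... | yes x<σx | yes σx<x = ⊥-elim (ℕ.<-asym x<σx σx<x)
  ... | yes _    | no _     = refl
  ... | no _     | yes _    = refl
  ... | no x≮σx  | no σx≮x  =
    ⊥-elim (fixedPointFree x (Fin.toℕ-injective (ℕ.≤-antisym (ℕ.≮⇒≥ x≮σx) (ℕ.≮⇒≥ σx≮x))))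

  above≡below : above ≡ below
  above≡below = trans (sum-permute _ (permutation σ σ involutive involutive))
                      (sum-cong-≗ (λ x → cong (λ y → [ y Fin.<? σ x ]) (involutive x)))

  m≡2*below : m ≡ 2 * below
  m≡2*below = begin
    m                                                    ≡⟨ sum-ones m ⟨
    sum {m} (λ _ → 1)                                    ≡⟨ sum-cong-≗ one-side ⟩
    sum (λ x → [ x Fin.<? σ x ] + [ σ x Fin.<? x ])      ≡⟨ ∑-distrib-+ {m} _ _ ⟩
    below + above                                        ≡⟨ cong (below +_) above≡below ⟩
    below + below                                        ≡⟨ cong (below +_) (ℕ.+-identityʳ below) ⟨
    2 * below                                            ∎
    where open ≡-Reasoning

module _ {m} {_∙_ : Fin m → Fin m → Fin m} {ε : Fin m} {_⁻¹ : Fin m → Fin m}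
         (isGroup : IsGroup _≡_ _∙_ ε _⁻¹) where

  private
    group : Group _ _
    group = record { isGroup = isGroup }

  open IsGroup isGroup using (assoc; identityˡ)
  open GroupProperties group using (identityˡ-unique)

  odd-order⇒x∙x≢ε : Odd m → ∀ {x} → x ≢ ε → x ∙ x ≢ ε
  odd-order⇒x∙x≢ε odd {x} x≢ε x∙x≡ε = fixedPointFreeInvolution⇒¬Odd (x ∙_) involutive fixedPointFree odd
    where
    involutive : ∀ y → x ∙ (x ∙ y) ≡ y
    involutive y = trans (sym (assoc x x y)) (trans (cong (_∙ y) x∙x≡ε) (identityˡ y))
    fixedPointFree : ∀ y → x ∙ y ≢ y
    fixedPointFree y x∙y≡y = x≢ε (identityˡ-unique x y x∙y≡y)

injective⇒surjective : ∀ {m} {f : Fin m → Fin m} → Injective _≡_ _≡_ f → ∀ y → ∃ λ x → f x ≡ y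
injective⇒surjective {suc m} {f} f-injective y with Fin.any? (λ x → f x Fin.≟ y)
... | yes hit = hit
... | no miss = ⊥-elim (ℕ.1+n≰n (Fin.injective⇒≤ punchOut∘f-injective))
  where
  y≢f : ∀ x → y ≢ f x
  y≢f x y≡fx = miss (x , sym y≡fx)
  punchOut∘f-injective : Injective _≡_ _≡_ (λ x → punchOut (y≢f x))
  punchOut∘f-injective eq = f-injective (Fin.punchOut-injective (y≢f _) (y≢f _) eq)

lookup-injective : ∀ {a ℓ} {A : Set a} {R : Rel A ℓ} → Symmetric R →
  ∀ {xs} → AllPairs (λ x y → ¬ R x y) xs → ∀ {i j} → R (lookup xs i) (lookup xs j) → i ≡ j
lookup-injective R-sym {_ ∷ _} (_ ∷ _) {zero} {zero} _ = refl
lookup-injective R-sym (¬R ∷ _) {zero} {suc j} R0j = ⊥-elim (All.lookup ¬R (∈-lookup j) R0j)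
lookup-injective R-sym (¬R ∷ _) {suc i} {zero} Ri0 = ⊥-elim (All.lookup ¬R (∈-lookup i) (R-sym Ri0))
lookup-injective R-sym (_ ∷ distinct) {suc i} {suc j} Rij = cong suc (lookup-injective R-sym distinct Rij)

module AbelianGroupLemmas {v} (_⊕_ : Fin v → Fin v → Fin v) (0ᴳ : Fin v) (⊖_ : Fin v → Fin v)
  (isAbelianGroup : IsAbelianGroup _≡_ _⊕_ 0ᴳ ⊖_) where

  open IsAbelianGroup isAbelianGroup using (isGroup; assoc; identityˡ; inverseˡ)
  open IsAbelianGroup isAbelianGroup public using (comm; inverseʳ)

  private
    group : Group _ _
    group = record { isGroup = isGroup }

  open GroupProperties group using (identityʳ-unique; inverseˡ-unique)
  open GroupProperties group public using (⁻¹-involutive; x∙y⁻¹≈ε⇒x≈y)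

  infixl 6 _−_
  _−_ : Fin v → Fin v → Fin v
  x − y = x ⊕ (⊖ y)

  −-telescope : ∀ a b c → (a − b) ⊕ (b − c) ≡ a − c
  −-telescope a b c = begin
    (a − b) ⊕ (b − c)          ≡⟨ assoc a (⊖ b) (b − c) ⟩
    a ⊕ ((⊖ b) ⊕ (b − c))      ≡⟨ cong (a ⊕_) (assoc (⊖ b) b (⊖ c)) ⟨
    a ⊕ (((⊖ b) ⊕ b) ⊕ (⊖ c))  ≡⟨ cong (λ t → a ⊕ (t ⊕ (⊖ c))) (inverseˡ b) ⟩
    a ⊕ (0ᴳ ⊕ (⊖ c))           ≡⟨ cong (a ⊕_) (identityˡ (⊖ c)) ⟩
    a − c                      ∎
    where open ≡-Reasoning

  −-exchange : ∀ a b c d → a − b ≡ c − d → b − d ≡ a − c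
  −-exchange a b c d a−b≡c−d = begin
    b − d                  ≡⟨ −-telescope b c d ⟨
    (b − c) ⊕ (c − d)      ≡⟨ cong ((b − c) ⊕_) a−b≡c−d ⟨
    (b − c) ⊕ (a − b)      ≡⟨ comm (b − c) (a − b) ⟩
    (a − b) ⊕ (b − c)      ≡⟨ −-telescope a b c ⟩
    a − c                  ∎
    where open ≡-Reasoning

  x≡⊖x⇒x≡0 : Odd v → ∀ {x} → x ≡ ⊖ x → x ≡ 0ᴳ
  x≡⊖x⇒x≡0 odd {x} x≡⊖x with x Fin.≟ 0ᴳ
  ... | yes x≡0 = x≡0
  ... | no x≢0 = ⊥-elim (odd-order⇒x∙x≢ε isGroup odd x≢0 (trans (cong (x ⊕_) x≡⊖x) (inverseʳ x)))

  module Automorphism {σ : Fin v → Fin v} (σ-automorphism : IsAutomorphism _⊕_ 0ᴳ ⊖_ σ) where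

    σ-⊕ : ∀ x y → σ (x ⊕ y) ≡ σ x ⊕ σ y
    σ-⊕ = proj₁ σ-automorphism

    σ-injective : Injective _≡_ _≡_ σ
    σ-injective = proj₁ (proj₂ σ-automorphism)

    σ-surjective : ∀ y → ∃ λ x → σ x ≡ y
    σ-surjective y = let (x , σx≡y) = proj₂ (proj₂ σ-automorphism) y in x , σx≡y refl

    σ-0 : σ 0ᴳ ≡ 0ᴳ
    σ-0 = identityʳ-unique (σ 0ᴳ) (σ 0ᴳ) (trans (sym (σ-⊕ 0ᴳ 0ᴳ)) (cong σ (identityˡ 0ᴳ)))

    σ-⊖ : ∀ x → σ (⊖ x) ≡ ⊖ (σ x)
    σ-⊖ x = inverseˡ-unique (σ (⊖ x)) (σ x) (trans (sym (σ-⊕ (⊖ x) x)) (trans (cong σ (inverseˡ x)) σ-0))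

    σ-− : ∀ x y → σ (x − y) ≡ σ x − σ y
    σ-− x y = trans (σ-⊕ x (⊖ y)) (cong (σ x ⊕_) (σ-⊖ y))

    σ-≢0 : ∀ {x} → x ≢ 0ᴳ → σ x ≢ 0ᴳ
    σ-≢0 x≢0 σx≡0 = x≢0 (σ-injective (trans σx≡0 (sym σ-0)))

module AutomorphismGroup {v} (_⊕_ : Fin v → Fin v → Fin v) (0ᴳ : Fin v) (⊖_ : Fin v → Fin v)
  (isAbelianGroup : IsAbelianGroup _≡_ _⊕_ 0ᴳ ⊖_)
  (As : List (Fin v → Fin v)) (isAutGroup : IsAutGroup _⊕_ 0ᴳ ⊖_ As) where

  open AbelianGroupLemmas _⊕_ 0ᴳ ⊖_ isAbelianGroup public

  Index : Set
  Index = Fin (length As)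

  act : Index → Fin v → Fin v
  act = lookup As

  private
    automorphic : ∀ i → IsAutomorphism _⊕_ 0ᴳ ⊖_ (act i)
    automorphic i = All.lookup (proj₁ isAutGroup) (∈-lookup i)

    distinct : AllPairs (λ σ τ → ¬ (σ ≗ᶠ τ)) As
    distinct = proj₁ (proj₂ isAutGroup)

    has-identity : (λ x → x) ∈ᶠ As
    has-identity = proj₁ (proj₂ (proj₂ isAutGroup))

    closed : ∀ i j → (λ x → act i (act j x)) ∈ᶠ As
    closed i j = All.lookup (All.lookup (proj₁ (proj₂ (proj₂ (proj₂ isAutGroup)))) (∈-lookup i)) (∈-lookup j)

    invertible : ∀ i → Any (λ τ → (λ x → τ (act i x)) ≗ᶠ (λ x → x)) As
    invertible i = All.lookup (proj₂ (proj₂ (proj₂ (proj₂ isAutGroup)))) (∈-lookup i)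

  module Act (i : Index) = Automorphism (automorphic i)

  act-faithful : ∀ {i j} → act i ≗ᶠ act j → i ≡ j
  act-faithful = lookup-injective (λ f≗g x → sym (f≗g x)) distinct

  ι : Index
  ι = Any.index has-identity

  infixl 7 _·_
  _·_ : Index → Index → Index
  i · j = Any.index (closed i j)

  infix 8 _⁻¹
  _⁻¹ : Index → Index
  i ⁻¹ = Any.index (invertible i)

  act-ι : ∀ x → act ι x ≡ x
  act-ι = lookup-index has-identity

  act-· : ∀ i j x → act (i · j) x ≡ act i (act j x)
  act-· i j = lookup-index (closed i j)

  act-⁻¹ˡ : ∀ i x → act (i ⁻¹) (act i x) ≡ x
  act-⁻¹ˡ i = lookup-index (invertible i)

  act-⁻¹ʳ : ∀ i x → act i (act (i ⁻¹) x) ≡ x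
  act-⁻¹ʳ i x with y , refl ← Act.σ-surjective i x = cong (act i) (act-⁻¹ˡ i y)

  isGroup-A : IsGroup _≡_ _·_ ι _⁻¹
  isGroup-A = record
    { isMonoid = record
      { isSemigroup = record
        { isMagma = record { isEquivalence = isEquivalence ; ∙-cong = cong₂ _·_ }
        ; assoc = λ i j k → act-faithful λ x → begin
            act (i · j · k) x        ≡⟨ act-· (i · j) k x ⟩
            act (i · j) (act k x)    ≡⟨ act-· i j (act k x) ⟩
            act i (act j (act k x))  ≡⟨ cong (act i) (act-· j k x) ⟨
            act i (act (j · k) x)    ≡⟨ act-· i (j · k) x ⟨
            act (i · (j · k)) x      ∎
        }
      ; identity = (λ i → act-faithful λ x → trans (act-· ι i x) (act-ι (act i x)))
                 , (λ i → act-faithful λ x → trans (act-· i ι x) (cong (act i) (act-ι x)))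
      }
    ; inverse = (λ i → act-faithful λ x → trans (act-· (i ⁻¹) i x) (trans (act-⁻¹ˡ i x) (sym (act-ι x))))
              , (λ i → act-faithful λ x → trans (act-· i (i ⁻¹) x) (trans (act-⁻¹ʳ i x) (sym (act-ι x))))
    ; ⁻¹-cong = cong _⁻¹
    }
    where open ≡-Reasoning

  group-A : Group _ _
  group-A = record { isGroup = isGroup-A }

  module A = GroupProperties group-A

  sum-·ʳ : ∀ i (h : Index → ℕ) → sum h ≡ sum (λ ρ → h (ρ · i))
  sum-·ʳ i h = sum-permute h (permutation (_· i) (_· i ⁻¹) (A.//-rightDividesˡ i) (A.//-rightDividesʳ i))

  count-non-identity : sum (λ ρ → [ ¬? (ρ Fin.≟ ι) ]) ≡ length As ∸ 1
  count-non-identity = begin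
    others                            ≡⟨ ℕ.m+n∸m≡n 1 others ⟨
    1 + others ∸ 1                    ≡⟨ cong (λ t → t + others ∸ 1) identity-once ⟨
    identities + others ∸ 1           ≡⟨ cong (_∸ 1) (∑-distrib-+ (λ ρ → [ ρ Fin.≟ ι ]) _) ⟨
    sum (λ ρ → [ ρ Fin.≟ ι ] + [ ¬? (ρ Fin.≟ ι) ]) ∸ 1
                                      ≡⟨ cong (_∸ 1) (sum-cong-≗ (λ ρ → []-complement (ρ Fin.≟ ι))) ⟩
    sum {length As} (λ _ → 1) ∸ 1     ≡⟨ cong (_∸ 1) (sum-ones (length As)) ⟩
    length As ∸ 1                     ∎
    where
    open ≡-Reasoning
    identities others : ℕ
    identities = sum (λ ρ → [ ρ Fin.≟ ι ])
    others = sum (λ ρ → [ ¬? (ρ Fin.≟ ι) ])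
    identity-once : identities ≡ 1
    identity-once = trans (sum-cong-≗ (λ ρ → sym (ℕ.*-identityʳ [ ρ Fin.≟ ι ])))
                          (sum-iverson-unique (Fin._≟ ι) (λ _ → 1) refl (λ ρ≡ι → ρ≡ι))

module BanffConstruction {v} (_⊕_ : Fin v → Fin v → Fin v) (0ᴳ : Fin v) (⊖_ : Fin v → Fin v)
  (isAbelianGroup : IsAbelianGroup _≡_ _⊕_ 0ᴳ ⊖_) (odd-v : Odd v)
  (As : List (Fin v → Fin v)) (isAutGroup : IsAutGroup _⊕_ 0ᴳ ⊖_ As) (odd-k : Odd (length As))
  (fixedPointFree : FixedPointFree _⊕_ 0ᴳ ⊖_ As) where

  open AutomorphismGroup _⊕_ 0ᴳ ⊖_ isAbelianGroup As isAutGroup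
  fixes-nonzero⇒≡ι : ∀ {i x} → x ≢ 0ᴳ → act i x ≡ x → i ≡ ι
  fixes-nonzero⇒≡ι {i} {x} x≢0 fixes with i Fin.≟ ι
  ... | yes i≡ι = i≡ι
  ... | no i≢ι = ⊥-elim (x≢0 (All.lookup fixedPointFree (∈-lookup i) act-i≉id x fixes))
    where
    act-i≉id : ¬ (act i ≗ᶠ (λ y → y))
    act-i≉id act-i≗id = i≢ι (act-faithful λ y → trans (act-i≗id y) (sym (act-ι y)))

  orbit-injective : ∀ {x} → x ≢ 0ᴳ → ∀ {i j} → act i x ≡ act j x → i ≡ j
  orbit-injective {x} x≢0 {i} {j} ix≡jx = A.x∙y⁻¹≈ε⇒x≈y i j (fixes-nonzero⇒≡ι (Act.σ-≢0 j x≢0) (begin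
    act (i · j ⁻¹) (act j x)      ≡⟨ act-· i (j ⁻¹) (act j x) ⟩
    act i (act (j ⁻¹) (act j x))  ≡⟨ cong (act i) (act-⁻¹ˡ j x) ⟩
    act i x                       ≡⟨ ix≡jx ⟩
    act j x                       ∎))
    where open ≡-Reasoning

  _∈Orbit_ : Fin v → Fin v → Set
  z ∈Orbit x = ∃ λ i → act i x ≡ z

  _∈Orbit?_ : ∀ z x → Dec (z ∈Orbit x)
  z ∈Orbit? x = Fin.any? (λ i → act i x Fin.≟ z)

  ∈Orbit-refl : ∀ {x} → x ∈Orbit x
  ∈Orbit-refl {x} = ι , act-ι x

  ∈Orbit-sym : ∀ {x z} → z ∈Orbit x → x ∈Orbit z
  ∈Orbit-sym {x} (i , refl) = i ⁻¹ , act-⁻¹ˡ i x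

  ∈Orbit-trans : ∀ {x y z} → z ∈Orbit y → y ∈Orbit x → z ∈Orbit x
  ∈Orbit-trans {x} (i , refl) (j , refl) = i · j , act-· i j x

  ⊖-∈Orbit : ∀ {y z} → z ∈Orbit (⊖ y) → (⊖ z) ∈Orbit y
  ⊖-∈Orbit {y} (i , refl) = i , trans (sym (⁻¹-involutive (act i y))) (cong ⊖_ (sym (Act.σ-⊖ i y)))

  -- For i ≠ ι, i · i fixes x, so i would have order two in the group A of odd order.
  ⊖x∉Orbit-x : ∀ {x} → x ≢ 0ᴳ → ¬ (⊖ x) ∈Orbit x
  ⊖x∉Orbit-x {x} x≢0 (i , ix≡⊖x) with i Fin.≟ ι
  ... | yes refl = x≢0 (x≡⊖x⇒x≡0 odd-v (trans (sym (act-ι x)) ix≡⊖x))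
  ... | no i≢ι = odd-order⇒x∙x≢ε isGroup-A odd-k i≢ι (fixes-nonzero⇒≡ι x≢0 (begin
    act (i · i) x    ≡⟨ act-· i i x ⟩
    act i (act i x)  ≡⟨ cong (act i) ix≡⊖x ⟩
    act i (⊖ x)      ≡⟨ Act.σ-⊖ i x ⟩
    ⊖ (act i x)      ≡⟨ cong ⊖_ ix≡⊖x ⟩
    ⊖ (⊖ x)          ≡⟨ ⁻¹-involutive x ⟩
    x                ∎))
    where open ≡-Reasoning

  opposite-orbits : ∀ {x y z} → z ∈Orbit x → (⊖ z) ∈Orbit y → x ∈Orbit (⊖ y)
  opposite-orbits z∈x ⊖z∈y = ∈Orbit-trans (∈Orbit-sym z∈x) (∈Orbit-sym (⊖-∈Orbit (∈Orbit-sym ⊖z∈y)))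

  _∈Orbits_ : Fin v → List (Fin v) → Set
  z ∈Orbits R = Any (z ∈Orbit_) R

  _∈Orbits?_ : ∀ z R → Dec (z ∈Orbits R)
  z ∈Orbits? R = Any.any? (z ∈Orbit?_) R

  record Independent (R : List (Fin v)) : Set where
    field
      nonzero : All (_≢ 0ᴳ) R
      orbits-disjoint : AllPairs (λ x y → ¬ x ∈Orbit y) R
      no-opposite : ∀ {x y} → x ∈ R → y ∈ R → ¬ x ∈Orbit (⊖ y)

  Covering : List (Fin v) → Set
  Covering R = ∀ z → z ≢ 0ᴳ → z ∈Orbits R ⊎ (⊖ z) ∈Orbits R

  extend : List (Fin v) → Fin v → List (Fin v)
  extend R w with w Fin.≟ 0ᴳ | w ∈Orbits? R | (⊖ w) ∈Orbits? R
  ... | no _ | no _ | no _ = w ∷ R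
  ... | _    | _    | _    = R

  extend-independent : ∀ {R} w → Independent R → Independent (extend R w)
  extend-independent {R} w I with w Fin.≟ 0ᴳ | w ∈Orbits? R | (⊖ w) ∈Orbits? R
  ... | yes _  | _     | _      = I
  ... | no _   | yes _ | _      = I
  ... | no _   | no _  | yes _  = I
  ... | no w≢0 | no w∉ | no ⊖w∉ = record
    { nonzero = w≢0 ∷ nonzero
    ; orbits-disjoint = All.tabulate (λ y∈R w∈y → w∉ (lose y∈R w∈y)) ∷ orbits-disjoint
    ; no-opposite = no-opposite′
    }
    where
    open Independent I
    no-opposite′ : ∀ {x y} → x ∈ w ∷ R → y ∈ w ∷ R → ¬ x ∈Orbit (⊖ y)
    no-opposite′ (here refl) (here refl) w∈⊖w = ⊖x∉Orbit-x w≢0 (∈Orbit-sym w∈⊖w)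
    no-opposite′ (here refl) (there y∈R) w∈⊖y =
      ⊖w∉ (lose y∈R (⊖-∈Orbit w∈⊖y))
    no-opposite′ (there x∈R) (here refl) x∈⊖w = ⊖w∉ (lose x∈R (∈Orbit-sym x∈⊖w))
    no-opposite′ (there x∈R) (there y∈R) = no-opposite x∈R y∈R

  extend-⊇ : ∀ {R z} w → z ∈Orbits R → z ∈Orbits extend R w
  extend-⊇ {R} w z∈R with w Fin.≟ 0ᴳ | w ∈Orbits? R | (⊖ w) ∈Orbits? R
  ... | yes _ | _     | _     = z∈R
  ... | no _  | yes _ | _     = z∈R
  ... | no _  | no _  | yes _ = z∈R
  ... | no _  | no _  | no _  = there z∈R

  extend-covers : ∀ {R w} → w ≢ 0ᴳ → w ∈Orbits extend R w ⊎ (⊖ w) ∈Orbits extend R w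
  extend-covers {R} {w} w≢0 with w Fin.≟ 0ᴳ | w ∈Orbits? R | (⊖ w) ∈Orbits? R
  ... | yes w≡0 | _        | _         = ⊥-elim (w≢0 w≡0)
  ... | no _    | yes w∈   | _         = inj₁ w∈
  ... | no _    | no _     | yes ⊖w∈   = inj₂ ⊖w∈
  ... | no _    | no _     | no _      = inj₁ (here ∈Orbit-refl)

  foldl-extend-independent : ∀ {R} ws → Independent R → Independent (foldl extend R ws)
  foldl-extend-independent []       I = I
  foldl-extend-independent (w ∷ ws) I = foldl-extend-independent ws (extend-independent w I)

  foldl-extend-⊇ : ∀ {R z} ws → z ∈Orbits R → z ∈Orbits foldl extend R ws
  foldl-extend-⊇ []       z∈R = z∈R
  foldl-extend-⊇ (w ∷ ws) z∈R = foldl-extend-⊇ ws (extend-⊇ w z∈R)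

  foldl-extend-covers : ∀ {R z} ws → z ∈ ws → z ≢ 0ᴳ →
    z ∈Orbits foldl extend R ws ⊎ (⊖ z) ∈Orbits foldl extend R ws
  foldl-extend-covers (w ∷ ws) (here refl) z≢0 =
    Sum.map (foldl-extend-⊇ ws) (foldl-extend-⊇ ws) (extend-covers z≢0)
  foldl-extend-covers (w ∷ ws) (there z∈ws) z≢0 = foldl-extend-covers ws z∈ws z≢0

  representatives : List (Fin v)
  representatives = foldl extend [] (allFin v)

  representatives-independent : Independent representatives
  representatives-independent = foldl-extend-independent (allFin v) (record
    { nonzero = [] ; orbits-disjoint = [] ; no-opposite = λ () })

  representatives-covering : Covering representatives
  representatives-covering z = foldl-extend-covers (allFin v) (∈-allFin z)

  open Independent representatives-independent

  chosen : Fin v → ℕ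
  chosen z = [ z ∈Orbits? representatives ]

  chosen-act : ∀ i z → chosen (act i z) ≡ chosen z
  chosen-act i z = []-cong (Any.map (∈Orbit-trans (∈Orbit-sym (i , refl)))) (Any.map (∈Orbit-trans (i , refl)))
                           (act i z ∈Orbits? representatives) (z ∈Orbits? representatives)

  not-both-opposite : ∀ {z} → z ∈Orbits representatives → ¬ (⊖ z) ∈Orbits representatives
  not-both-opposite z∈ ⊖z∈ with x , x∈R , z∈x ← find z∈ | y , y∈R , ⊖z∈y ← find ⊖z∈ =
    no-opposite x∈R y∈R (opposite-orbits z∈x ⊖z∈y)

  chosen-opposite : ∀ {z} → z ≢ 0ᴳ → chosen z + chosen (⊖ z) ≡ 1
  chosen-opposite {z} z≢0 with representatives-covering z z≢0
  ... | inj₁ z∈  = cong₂ _+_ ([]-yes (z ∈Orbits? _) z∈)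
                            ([]-no ((⊖ z) ∈Orbits? _) (not-both-opposite z∈))
  ... | inj₂ ⊖z∈ = cong₂ _+_ ([]-no (z ∈Orbits? _) (λ z∈ → not-both-opposite z∈ ⊖z∈))
                            ([]-yes ((⊖ z) ∈Orbits? _) ⊖z∈)

  sum-orbit : ∀ {x} → x ≢ 0ᴳ → (h : Fin v → ℕ) →
    sum (λ i → h (act i x)) ≡ sum (λ z → [ z ∈Orbit? x ] * h z)
  sum-orbit {x} x≢0 h = begin
    sum (λ i → h (act i x))                            ≡⟨ sum-cong-≗ kronecker ⟨
    sum (λ i → sum (λ z → [ act i x Fin.≟ z ] * h z))  ≡⟨ ∑-comm (λ i z → [ act i x Fin.≟ z ] * h z) ⟩
    sum (λ z → sum (λ i → [ act i x Fin.≟ z ] * h z))  ≡⟨ sum-cong-≗ collapse ⟩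
    sum (λ z → [ z ∈Orbit? x ] * h z)                  ∎
    where
    open ≡-Reasoning
    kronecker : ∀ i → sum (λ z → [ act i x Fin.≟ z ] * h z) ≡ h (act i x)
    kronecker i = sum-iverson-unique (act i x Fin.≟_) h refl sym
    collapse : ∀ z → sum (λ i → [ act i x Fin.≟ z ] * h z) ≡ [ z ∈Orbit? x ] * h z
    collapse z with z ∈Orbit? x
    ... | yes (i , ix≡z) = trans (sum-iverson-unique (λ j → act j x Fin.≟ z) (λ _ → h z) ix≡z
                                    (λ jx≡z → orbit-injective x≢0 (trans jx≡z (sym ix≡z))))
                                 (sym (ℕ.+-identityʳ (h z)))
    ... | no z∉ = sum-iverson-none (λ j → act j x Fin.≟ z) (λ _ → h z) (λ j jx≡z → z∉ (j , jx≡z))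

  sum-chosen-orbits : (h : Fin v → ℕ) →
    sumᴸ (map (λ x → sum (λ i → h (act i x))) representatives) ≡ sum (λ z → chosen z * h z)
  sum-chosen-orbits h = begin
    sumᴸ (map (λ x → sum (λ i → h (act i x))) representatives)
      ≡⟨ cong sumᴸ (List.map-cong-local (All.map (λ x≢0 → sum-orbit x≢0 h) nonzero)) ⟩
    sumᴸ (map (λ x → sum (λ z → [ z ∈Orbit? x ] * h z)) representatives)
      ≡⟨ sumᴸ-sum-comm (λ x z → [ z ∈Orbit? x ] * h z) representatives ⟩
    sum (λ z → sumᴸ (map (λ x → [ z ∈Orbit? x ] * h z) representatives))
      ≡⟨ sum-cong-≗ (λ z → sumᴸ-* (λ x → [ z ∈Orbit? x ]) (h z) representatives) ⟩
    sum (λ z → sumᴸ (map (λ x → [ z ∈Orbit? x ]) representatives) * h z)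
      ≡⟨ sum-cong-≗ (λ z → cong (_* h z) (sumᴸ-exclusive (z ∈Orbit?_) representatives (exclusive z)
                                                           (z ∈Orbits? representatives))) ⟩
    sum (λ z → chosen z * h z) ∎
    where
    open ≡-Reasoning
    exclusive : ∀ z → AllPairs (λ x y → ¬ (z ∈Orbit x × z ∈Orbit y)) representatives
    exclusive z = AllPairs.map (λ x∉y (z∈x , z∈y) → x∉y (∈Orbit-trans (∈Orbit-sym z∈x) z∈y)) orbits-disjoint

  block : Fin v → List (Fin v)
  block x = tabulate (λ i → act i x)

  family : List (List (Fin v))
  family = map block representatives

  displacement : Index → Fin v → Fin v
  displacement ρ z = z − act ρ z

  displacement-injective : ∀ {ρ} → ρ ≢ ι → Injective _≡_ _≡_ (displacement ρ)
  displacement-injective {ρ} ρ≢ι {x} {z} dx≡dz with (x − z) Fin.≟ 0ᴳ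
  ... | yes x−z≡0 = x∙y⁻¹≈ε⇒x≈y x z x−z≡0
  ... | no x−z≢0 = ⊥-elim (ρ≢ι (fixes-nonzero⇒≡ι x−z≢0
          (trans (Act.σ-− ρ x z) (−-exchange x (act ρ x) z (act ρ z) dx≡dz))))

  module DifferenceCount (g : Fin v) (g≢0 : g ≢ 0ᴳ) where

    through : Fin v → ℕ
    through z = sum (λ ρ → [ displacement ρ z Fin.≟ g ])

    hits : Index → ℕ
    hits ρ = sum (λ z → chosen z * [ displacement ρ z Fin.≟ g ])

    row-count : ∀ u (B : List (Fin v)) →
      length (filter (Fin._≟ g) (map (u −_) (filter (λ y → ¬? (u Fin.≟ y)) B))) ≡ sumᴸ (map (λ y → [ u − y Fin.≟ g ]) B)
    row-count u B = begin
      length (filter (Fin._≟ g) (map (u −_) (filter (λ y → ¬? (u Fin.≟ y)) B)))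
        ≡⟨ length-filter (Fin._≟ g) (map (u −_) (filter (λ y → ¬? (u Fin.≟ y)) B)) ⟩
      sumᴸ (map (λ d → [ d Fin.≟ g ]) (map (u −_) (filter (λ y → ¬? (u Fin.≟ y)) B)))
        ≡⟨ cong sumᴸ (List.map-∘ (filter (λ y → ¬? (u Fin.≟ y)) B)) ⟨
      sumᴸ (map (λ y → [ u − y Fin.≟ g ]) (filter (λ y → ¬? (u Fin.≟ y)) B))
        ≡⟨ sumᴸ-filter (λ y → ¬? (u Fin.≟ y)) (λ y → [ u − y Fin.≟ g ]) u−u≢g B ⟩
      sumᴸ (map (λ y → [ u − y Fin.≟ g ]) B) ∎
      where
      open ≡-Reasoning
      u−u≢g : ∀ y → ¬ ¬ u ≡ y → [ u − y Fin.≟ g ] ≡ 0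
      u−u≢g y ¬u≢y = []-no (u − y Fin.≟ g) λ u−y≡g →
        g≢0 (trans (sym u−y≡g) (trans (cong (u −_) (sym (decidable-stable (u Fin.≟ y) ¬u≢y))) (inverseʳ u)))

    block-count : ∀ x → length (filter (Fin._≟ g) (diffs _⊕_ 0ᴳ ⊖_ (block x))) ≡ sum (λ i → through (act i x))
    block-count x = begin
      length (filter (Fin._≟ g) (diffs _⊕_ 0ᴳ ⊖_ (block x)))
        ≡⟨ length-filter-concatMap (Fin._≟ g) _ (block x) ⟩
      sumᴸ (map (λ u → length (filter (Fin._≟ g) (map (u −_) (filter (λ y → ¬? (u Fin.≟ y)) (block x))))) (block x))
        ≡⟨ cong sumᴸ (List.map-cong (λ u → row-count u (block x)) (block x)) ⟩
      sumᴸ (map (λ u → sumᴸ (map (λ y → [ u − y Fin.≟ g ]) (block x))) (block x))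
        ≡⟨ sumᴸ-map-tabulate (λ u → sumᴸ (map (λ y → [ u − y Fin.≟ g ]) (block x))) (λ i → act i x) ⟩
      sum (λ i → sumᴸ (map (λ y → [ act i x − y Fin.≟ g ]) (block x)))
        ≡⟨ sum-cong-≗ (λ i → sumᴸ-map-tabulate (λ y → [ act i x − y Fin.≟ g ]) (λ j → act j x)) ⟩
      sum (λ i → sum (λ j → [ act i x − act j x Fin.≟ g ]))
        ≡⟨ sum-cong-≗ (λ i → trans (sum-·ʳ i _)
             (sum-cong-≗ λ ρ → cong (λ t → [ act i x − t Fin.≟ g ]) (act-· ρ i x))) ⟩
      sum (λ i → through (act i x)) ∎
      where open ≡-Reasoning

    diffCount-family : diffCount _⊕_ 0ᴳ ⊖_ family g ≡ sum hits
    diffCount-family = begin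
      diffCount _⊕_ 0ᴳ ⊖_ family g
        ≡⟨ length-filter-concatMap (Fin._≟ g) (diffs _⊕_ 0ᴳ ⊖_) family ⟩
      sumᴸ (map (λ B → length (filter (Fin._≟ g) (diffs _⊕_ 0ᴳ ⊖_ B))) (map block representatives))
        ≡⟨ cong sumᴸ (List.map-∘ representatives) ⟨
      sumᴸ (map (λ x → length (filter (Fin._≟ g) (diffs _⊕_ 0ᴳ ⊖_ (block x)))) representatives)
        ≡⟨ cong sumᴸ (List.map-cong block-count representatives) ⟩
      sumᴸ (map (λ x → sum (λ i → through (act i x))) representatives)
        ≡⟨ sum-chosen-orbits through ⟩
      sum (λ z → chosen z * through z)
        ≡⟨ sum-cong-≗ (λ z → *-distribˡ-sum (chosen z) (λ ρ → [ displacement ρ z Fin.≟ g ])) ⟩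
      sum (λ z → sum (λ ρ → chosen z * [ displacement ρ z Fin.≟ g ]))
        ≡⟨ ∑-comm (λ z ρ → chosen z * [ displacement ρ z Fin.≟ g ]) ⟩
      sum hits ∎
      where open ≡-Reasoning

    hits-ι : hits ι ≡ 0
    hits-ι = sum-zero _ λ z →
      trans (cong (chosen z *_) ([]-no (displacement ι z Fin.≟ g) (dι≢g z))) (ℕ.*-zeroʳ (chosen z))
      where
      dι≢g : ∀ z → displacement ι z ≢ g
      dι≢g z dz≡g = g≢0 (trans (sym dz≡g) (trans (cong (z −_) (act-ι z)) (inverseʳ z)))

    hits-solution : ∀ {ρ y} → ρ ≢ ι → displacement ρ y ≡ g → hits ρ ≡ chosen y
    hits-solution {ρ} ρ≢ι dy≡g =
      trans (sum-cong-≗ (λ z → ℕ.*-comm (chosen z) [ displacement ρ z Fin.≟ g ]))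
            (sum-iverson-unique (λ z → displacement ρ z Fin.≟ g) chosen dy≡g
              (λ dz≡g → displacement-injective ρ≢ι (trans dz≡g (sym dy≡g))))

    hits-pair : ∀ ρ → hits ρ + hits (ρ ⁻¹) ≡ [ ¬? (ρ Fin.≟ ι) ]
    hits-pair ρ with ρ Fin.≟ ι
    ... | yes refl = cong₂ _+_ hits-ι (trans (cong hits A.ε⁻¹≈ε) hits-ι)
    ... | no ρ≢ι with y , dy≡g ← injective⇒surjective (displacement-injective ρ≢ι) g = begin
      hits ρ + hits (ρ ⁻¹)                      ≡⟨ cong₂ _+_ (hits-solution ρ≢ι dy≡g) (hits-solution ρ⁻¹≢ι d⁻¹≡g) ⟩
      chosen y + chosen (⊖ (act ρ y))           ≡⟨ cong (_+ chosen (⊖ (act ρ y))) (chosen-act ρ y) ⟨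
      chosen (act ρ y) + chosen (⊖ (act ρ y))   ≡⟨ chosen-opposite (Act.σ-≢0 ρ y≢0) ⟩
      1                                         ∎
      where
      open ≡-Reasoning
      ρ⁻¹≢ι : ρ ⁻¹ ≢ ι
      ρ⁻¹≢ι ρ⁻¹≡ι = ρ≢ι (A.⁻¹-injective (trans ρ⁻¹≡ι (sym A.ε⁻¹≈ε)))
      y≢0 : y ≢ 0ᴳ
      y≢0 refl = g≢0 (trans (sym dy≡g) (trans (cong (0ᴳ −_) (Act.σ-0 ρ)) (inverseʳ 0ᴳ)))
      d⁻¹≡g : displacement (ρ ⁻¹) (⊖ (act ρ y)) ≡ g
      d⁻¹≡g = begin
        ⊖ (act ρ y) − act (ρ ⁻¹) (⊖ (act ρ y))    ≡⟨ cong (⊖ (act ρ y) −_) (Act.σ-⊖ (ρ ⁻¹) (act ρ y)) ⟩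
        ⊖ (act ρ y) − ⊖ (act (ρ ⁻¹) (act ρ y))    ≡⟨ cong (λ t → ⊖ (act ρ y) − ⊖ t) (act-⁻¹ˡ ρ y) ⟩
        ⊖ (act ρ y) − ⊖ y                          ≡⟨ cong ((⊖ (act ρ y)) ⊕_) (⁻¹-involutive y) ⟩
        (⊖ (act ρ y)) ⊕ y                          ≡⟨ comm (⊖ (act ρ y)) y ⟩
        y − act ρ y                                ≡⟨ dy≡g ⟩
        g                                          ∎

    sum-hits : sum hits ≡ (length As ∸ 1) / 2
    sum-hits = begin
      sum hits                     ≡⟨ m*n/n≡m (sum hits) 2 ⟨
      sum hits * 2 / 2             ≡⟨ cong (_/ 2) twice ⟩
      (length As ∸ 1) / 2          ∎
      where
      open ≡-Reasoning
      twice : sum hits * 2 ≡ length As ∸ 1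
      twice = begin
        sum hits * 2                               ≡⟨ ℕ.*-comm (sum hits) 2 ⟩
        sum hits + (sum hits + 0)                  ≡⟨ cong (sum hits +_) (ℕ.+-identityʳ (sum hits)) ⟩
        sum hits + sum hits
          ≡⟨ cong (sum hits +_) (sum-permute hits (permutation _⁻¹ _⁻¹ A.⁻¹-involutive A.⁻¹-involutive)) ⟩
        sum hits + sum (λ ρ → hits (ρ ⁻¹))         ≡⟨ ∑-distrib-+ hits (λ ρ → hits (ρ ⁻¹)) ⟨
        sum (λ ρ → hits ρ + hits (ρ ⁻¹))           ≡⟨ sum-cong-≗ hits-pair ⟩
        sum (λ ρ → [ ¬? (ρ Fin.≟ ι) ])             ≡⟨ count-non-identity ⟩
        length As ∸ 1                              ∎

  ∈-block⁻ : ∀ {x u} → u ∈ block x → u ∈Orbit x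
  ∈-block⁻ u∈ with i , u≡ix ← ∈-tabulate⁻ u∈ = i , sym u≡ix

  family-isBanffDF : IsBanffDF _⊕_ 0ᴳ ⊖_ (length As) ((length As ∸ 1) / 2) family
  family-isBanffDF = (blocks , λ g g≢0 → trans (diffCount-family g g≢0) (sum-hits g g≢0))
                   , disjoint , avoid-0 , avoid-opposite
    where
    open DifferenceCount using (diffCount-family; sum-hits)
    blocks : All (λ B → Unique B × length B ≡ length As) family
    blocks = All-map⁺ (All.map (λ x≢0 → Unique-tabulate⁺ (orbit-injective x≢0) , List.length-tabulate _) nonzero)
    disjoint : AllPairs (Disjoint _⊕_ 0ᴳ ⊖_) family
    disjoint = AllPairs-map⁺ (AllPairs.map (λ x∉y {u} u∈x u∈y →
      x∉y (∈Orbit-trans (∈Orbit-sym (∈-block⁻ u∈x)) (∈-block⁻ u∈y))) orbits-disjoint)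
    avoid-0 : All (λ B → 0ᴳ ∉ B) family
    avoid-0 = All-map⁺ (All.map (λ x≢0 0∈ → let i , ix≡0 = ∈-block⁻ 0∈ in Act.σ-≢0 i x≢0 ix≡0) nonzero)
    avoid-opposite : All (λ B → All (λ C → ∀ {u} → u ∈ B → (⊖ u) ∉ C) family) family
    avoid-opposite = All-map⁺ (All.tabulate λ x∈R → All-map⁺ (All.tabulate λ y∈R u∈x ⊖u∈y →
      no-opposite x∈R y∈R (opposite-orbits (∈-block⁻ u∈x) (∈-block⁻ ⊖u∈y))))

mainTheorem4 : (v k : ℕ) (_+_ : Fin v → Fin v → Fin v) (0# : Fin v) (-_ : Fin v → Fin v)
    → IsAbelianGroup _≡_ _+_ 0# -_
    → Odd v
    → (As : List (Fin v → Fin v))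
    → IsAutGroup _+_ 0# -_ As
    → length As ≡ k
    → Odd k
    → FixedPointFree _+_ 0# -_ As
    → ∃ λ (F : List (List (Fin v))) → IsBanffDF _+_ 0# -_ k ((k ∸ 1) / 2) F
mainTheorem4 v .(length As) _+_ 0# -_ isAbelianGroup odd-v As isAutGroup refl odd-k fixedPointFree =
  family , family-isBanffDF
  where open BanffConstruction _+_ 0# -_ isAbelianGroup odd-v As isAutGroup odd-k fixedPointFree
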